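{- Let $\mathcal{L}$ be any finite list of recurrent finite abelian processors. Then there exists $p\in\mathbb{N}$ such that no finite, directed acyclic abelian network whose components are taken from $\mathcal{L}$ emulates a $p$-toppler.
   Context: $\mathbb{N}=\{0,1,2,\dots\}$. A processor with finite input alphabet $A$, finite output alphabet $B$ and finite state space $Q$ consists of maps $t_i:Q\to Q$, $o_i:Q\to\mathbb{N}^B$ ($i\in A$): on receiving letter $i$ in state $q$ it moves to $t_i(q)$ and emits $(o_i(q))_b$ letters $b$. It is abelian if $t_it_j=t_jt_i$ and $o_i+o_j\circ t_i=o_j+o_i\circ t_j$. It has an initial state from which all states are reachable, computes the function giving the total output after receiving $x_a$ letters $a$ for each $a$, and is recurrent if any state can be reached from any other by some sequence of inputs. For an integer $\lambda\ge2$ a $\lambda$-toppler has one input, one output and states $0,\dots,\lambda-1$: a letter received in state $q<\lambda-1$ moves it to $q+1$ emitting nothing, and in state $\lambda-1$ moves it to $0$ emitting one letter; started in $q$ it computes $x\mapsto\lfloor (x+q)/\lambda\rfloor$. An abelian network is a finite directed multigraph with dangling input edges (no tail) and output/trash edges (no head), each node carrying a processor (with some initial state) fed along its incoming edges and emitting along its outgoing edges; it runs by repeatedly feeding a waiting letter on any non-output, non-trash edge into the processor at its head until all letters lie on output or trash edges. A directed acyclic network (no directed cycle) always halts and computes its input-output function; it emulates a processor if it computes the same function. -}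

module Defs where

open import Data.Nat using (ℕ; zero; suc; _+_; _∸_; _<_; _/_; NonZero)
open import Data.Fin using (Fin)
open import Data.Fin.Properties using (_≟_)
open import Data.List using (List; length; lookup; foldl)
open import Data.Product using (Σ; ∃; _×_; _,_)
open import Data.Sum using (_⊎_; inj₁; inj₂)
open import Data.Unit using (⊤; tt)
open import Relation.Binary.PropositionalEquality using (_≡_; refl)
open import Relation.Nullary using (¬_; yes; no)
open import Relation.Binary.Construct.Closure.ReflexiveTransitive using (Star)
open import Relation.Binary.Construct.Closure.Transitive using (TransClosure)

record Processor : Set where
  field
    nA nB nQ : ℕ
    t  : Fin nA → Fin nQ → Fin nQ
    o  : Fin nA → Fin nQ → Fin nB → ℕ
    q₀ : Fin nQ
open Processor public

run : (P : Processor) → List (Fin (nA P)) → Fin (nQ P) → Fin (nQ P)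
run P w q = foldl (λ s i → t P i s) q w

IsAbelian : Processor → Set
IsAbelian P =
  (∀ i j q → t P i (t P j q) ≡ t P j (t P i q)) ×
  (∀ i j q b → o P i q b + o P j (t P i q) b ≡ o P j q b + o P i (t P j q) b)

IsRecurrent : Processor → Set
IsRecurrent P = ∀ q q' → ∃ λ (w : List (Fin (nA P))) → run P w q ≡ q'

AllReachable : Processor → Set
AllReachable P = ∀ q → ∃ λ (w : List (Fin (nA P))) → run P w (q₀ P) ≡ q

-- Networks with components from L, with one input edge and one output
-- edge (any number of trash edges).  Edges are identified
-- with their heads: every input letter (port) of every node and the
-- output edge has a source, which is either the network's input edge
-- or an output letter (port) of some node.  Sources used by nobody are
-- trash edges.

record Net (L : List Processor) : Set where
  field
    n    : ℕ
    kind : Fin n → Fin (length L)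
  Pr : Fin n → Processor
  Pr v = lookup L (kind v)
  Src : Set
  Src = ⊤ ⊎ Σ (Fin n) (λ v → Fin (nB (Pr v)))
  Cons : Set
  Cons = Σ (Fin n) (λ v → Fin (nA (Pr v))) ⊎ ⊤
  field
    init   : (v : Fin n) → Fin (nQ (Pr v))
    src    : (v : Fin n) → Fin (nA (Pr v)) → Src
    outSrc : Src
  srcOf : Cons → Src
  srcOf (inj₁ (v , a)) = src v a
  srcOf (inj₂ _)       = outSrc

module _ {L : List Processor} (N : Net L) where
  open Net N

  -- multigraph well-formedness: each tail carries at most one edge
  WellWired : Set
  WellWired = ∀ c c' → srcOf c ≡ srcOf c' → c ≡ c'

  Adj : Fin n → Fin n → Set
  Adj u w = ∃ λ a → ∃ λ b → src w a ≡ inj₂ (u , b)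

  Acyclic : Set
  Acyclic = ∀ v → ¬ TransClosure Adj v v

  -- configurations: node states, letters waiting on edges into nodes,
  -- letters on the output edge (trash edges are not recorded)
  record Config : Set where
    field
      state : (v : Fin n) → Fin (nQ (Pr v))
      cnt   : (v : Fin n) → Fin (nA (Pr v)) → ℕ
      out   : ℕ
  open Config public

  contrib : (v : Fin n) → Fin (nA (Pr v)) → Fin (nQ (Pr v)) → Src → ℕ
  contrib v a q (inj₁ _) = 0
  contrib v a q (inj₂ (w , b)) with w ≟ v
  ... | yes refl = o (Pr v) a q b
  ... | no _ = 0

  here : (v : Fin n) → Fin (nA (Pr v)) → (w : Fin n) → Fin (nA (Pr w)) → ℕ
  here v a w a' with w ≟ v
  ... | no _ = 0
  ... | yes refl with a' ≟ a
  ...   | yes _ = 1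
  ...   | no _ = 0

  newState : (v : Fin n) → Fin (nA (Pr v)) → Config → (w : Fin n) → Fin (nQ (Pr w))
  newState v a c w with w ≟ v
  ... | yes refl = t (Pr v) a (state c v)
  ... | no _ = state c w

  fire : (v : Fin n) → Fin (nA (Pr v)) → Config → Config
  fire v a c = record
    { state = newState v a c
    ; cnt   = λ w a' → (cnt c w a' ∸ here v a w a') + contrib v a (state c v) (src w a')
    ; out   = out c + contrib v a (state c v) outSrc
    }

  data Step : Config → Config → Set where
    step : ∀ v a c → 0 < cnt c v a → Step c (fire v a c)

  fromInput : Src → ℕ → ℕ
  fromInput (inj₁ _) x = x
  fromInput (inj₂ _) x = 0

  initial : ℕ → Config
  initial x = record
    { state = init
    ; cnt   = λ w a → fromInput (src w a) x
    ; out   = fromInput outSrc x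
    }

  Halted : Config → Set
  Halted c = ∀ v a → cnt c v a ≡ 0

  Computes : (ℕ → ℕ) → Set
  Computes F = ∀ x →
    (∃ λ c → Star Step (initial x) c × Halted c) ×
    (∀ c → Star Step (initial x) c → Halted c → out c ≡ F x)

-- function computed by a λ-toppler started in state q
toppler : (p : ℕ) → .{{_ : NonZero p}} → ℕ → ℕ → ℕ
toppler p q x = (x + q) / p

module Submission where

-- No finite acyclic network of recurrent abelian processors taken from a
-- fixed finite list L emulates a p-toppler, for p = K + 1 where K is a
-- common period of all transitions of the processors of L.
--
-- The proof is by a conserved quantity.  For an abelian recurrent
-- processor with integer weights U on its output letters, the weight
-- emitted per input letter is a cocycle of the commuting transitions;
-- the module Straightening shows that, scaled by K^(A+1), it differs from
-- a constant by a coboundary.  This gives each input letter a weight and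
-- each state a potential such that processing a letter consumes exactly
-- its weight (ProcessorWeights).  In an acyclic network these weights can
-- be propagated backwards from the output edge; the common scaling factor
-- is absorbed by a stabilising iteration (NetworkWeights).  The weighted
-- count of letters plus the node potentials is then invariant under
-- firing (Conservation).  Feeding m·p letters to a network computing the
-- p-toppler yields m output letters, so boundedness of the potentials
-- forces outputWeight = p · inputValue; but outputWeight is a power of K,
-- which K + 1 does not divide.

open import Defs
open import Data.Nat as ℕ using (ℕ; zero; suc; _≤_; _<_; _∸_; _^_; _!; s≤s; z≤n; NonZero)
import Data.Nat.Properties as ℕP
open import Data.Integer as Int using (ℤ)
import Data.Integer.Properties as ℤP
open import Data.Integer.Tactic.RingSolver using (solve-∀)
open import Data.Fin using (Fin; zero; suc; toℕ)
open import Data.List using (List; []; _∷_)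
open import Data.Product using (_×_; _,_; proj₁; proj₂; ∃; ∃-syntax)
open import Function using (_∘_; id; flip)
open import Relation.Nullary using (¬_)
open import Relation.Binary.PropositionalEquality
open import Algebra.Properties.Semiring.Sum ℤP.+-*-semiring
  using (sum; sum-syntax; sum-cong-≗; ∑-distrib-+; ∑-comm; *-distribˡ-sum)
import Algebra.Properties.Semiring.Sum ℕP.+-*-semiring as ℕΣ
open import Data.Nat.Divisibility using (_∣_; divides; ∣-trans; m∣m*n; n∣m*n; m≤n⇒m!∣n!; ∣1⇒≡1)
open import Data.Nat.DivMod using (+-distrib-/-∣ˡ; m*n/n≡m; m<n⇒m/n≡0)
open import Data.Nat.Coprimality using (Coprime; coprime-+; coprime-divisor)
open import Data.Nat.GeneralisedArithmetic using (fold; fold-+)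
open import Data.Nat.ListAction using (product)
open import Data.Nat.ListAction.Properties using (∈⇒∣product; product≢0)
open import Data.Fin.Properties using (_≟_; pigeonhole; toℕ<n; suc-injective)
open import Data.Fin.Induction using (spo-noetherian)
open import Data.List using (length; allFin; lookup; map)
open import Data.List.Properties using (length-tabulate)
open import Data.List.Membership.Propositional using (_∈_)
open import Data.List.Membership.Propositional.Properties using (∈-allFin; ∈-map⁺; ∈-lookup)
import Data.List.Relation.Unary.Any as Any
open import Data.List.Relation.Unary.All as All using (All; universal)
open import Data.List.Relation.Unary.All.Properties using (map⁺)
open import Data.Sum using (inj₁; inj₂)
open import Data.Empty using (⊥-elim)
open import Relation.Nullary using (Dec; yes; no)
open import Relation.Binary.Construct.Closure.Transitive using (TransClosure; [_]; _++_)
open import Relation.Binary.Construct.Closure.ReflexiveTransitive using (Star; ε; _◅_)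
open import Induction.WellFounded using (Acc; acc; WellFounded)

module FiniteSums where
  open Int using (+_; _+_; _*_; -_; _-_; 0ℤ)

  ∑-neg : ∀ {n} (f : Fin n → ℤ) → ∑[ i < n ] (- f i) ≡ - sum f
  ∑-neg {zero}  f = refl
  ∑-neg {suc n} f = trans (cong (_+_ (- f zero)) (∑-neg (f ∘ suc))) (sym (ℤP.neg-distrib-+ (f zero) _))

  ∑-sub : ∀ {n} (f g : Fin n → ℤ) → ∑[ i < n ] (f i - g i) ≡ sum f - sum g
  ∑-sub f g = trans (∑-distrib-+ f (λ i → - g i)) (cong (_+_ (sum f)) (∑-neg g))

  ∑-zero : ∀ {n} (f : Fin n → ℤ) → (∀ i → f i ≡ 0ℤ) → sum f ≡ 0ℤ
  ∑-zero {zero}  f z = refl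
  ∑-zero {suc n} f z = cong₂ _+_ (z zero) (∑-zero (f ∘ suc) (z ∘ suc))

  ∑-δ : ∀ {n} (f : Fin n → ℤ) (v : Fin n) → (∀ w → w ≢ v → f w ≡ 0ℤ) → sum f ≡ f v
  ∑-δ {suc n} f zero    z = trans (cong (_+_ (f zero)) (∑-zero (f ∘ suc) (λ w → z (suc w) λ ()))) (ℤP.+-identityʳ _)
  ∑-δ {suc n} f (suc v) z =
    trans (cong₂ _+_ (z zero λ ()) (∑-δ (f ∘ suc) v (λ w w≢v → z (suc w) (w≢v ∘ suc-injective))))
          (ℤP.+-identityˡ _)

  sumBelow : ℕ → (ℕ → ℤ) → ℤ
  sumBelow m f = ∑[ j < m ] f (toℕ j)

  syntax sumBelow m (λ j → e) = ∑ℕ[ j < m ] e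

  sumBelow-cong : ∀ m {f g : ℕ → ℤ} → (∀ j → f j ≡ g j) → sumBelow m f ≡ sumBelow m g
  sumBelow-cong m f≗g = sum-cong-≗ {m} (f≗g ∘ toℕ)

  sumBelow-const : ∀ m c → ∑ℕ[ j < m ] c ≡ + m * c
  sumBelow-const zero    c = sym (ℤP.*-zeroˡ c)
  sumBelow-const (suc m) c = begin
    c + ∑ℕ[ j < m ] c  ≡⟨ cong (_+_ c) (sumBelow-const m c) ⟩
    c + + m * c        ≡⟨ solve c (+ m) ⟩
    (+ 1 + + m) * c    ≡⟨ cong (_* c) (sym (ℤP.pos-+ 1 m)) ⟩
    + suc m * c        ∎
    where open ≡-Reasoning
          solve : ∀ c m → c + m * c ≡ (+ 1 + m) * c
          solve = solve-∀

  sumBelow-shift : ∀ m (b : ℕ → ℤ) → ∑ℕ[ j < m ] b (suc j) + b 0 ≡ ∑ℕ[ j < m ] b j + b m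
  sumBelow-shift zero    b = refl
  sumBelow-shift (suc m) b = begin
    b 1 + S₂ + b 0      ≡⟨ solve (b 0) (b 1) S₂ ⟩
    b 0 + (S₂ + b 1)    ≡⟨ cong (_+_ (b 0)) (sumBelow-shift m (b ∘ suc)) ⟩
    b 0 + (S₁ + b (suc m)) ≡⟨ ℤP.+-assoc (b 0) S₁ (b (suc m)) ⟨
    b 0 + S₁ + b (suc m) ∎
    where
    open ≡-Reasoning
    S₁ = ∑ℕ[ j < m ] b (suc j)
    S₂ = ∑ℕ[ j < m ] b (suc (suc j))
    solve : ∀ x y s → y + s + x ≡ x + (s + y)
    solve = solve-∀

  telescope : ∀ m (F : ℕ → ℤ) → ∑ℕ[ j < m ] (F (suc j) - F j) ≡ F m - F 0
  telescope m F = begin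
    ∑ℕ[ j < m ] (F (suc j) - F j)              ≡⟨ ∑-sub {m} (F ∘ suc ∘ toℕ) (F ∘ toℕ) ⟩
    ∑ℕ[ j < m ] F (suc j) - ∑ℕ[ j < m ] F j    ≡⟨ solve (∑ℕ[ j < m ] F (suc j)) (∑ℕ[ j < m ] F j) (F 0) ⟩
    (∑ℕ[ j < m ] F (suc j) + F 0) - F 0 - ∑ℕ[ j < m ] F j
                                               ≡⟨ cong (λ x → x - F 0 - ∑ℕ[ j < m ] F j) (sumBelow-shift m F) ⟩
    (∑ℕ[ j < m ] F j + F m) - F 0 - ∑ℕ[ j < m ] F j ≡⟨ solve′ (∑ℕ[ j < m ] F j) (F m) (F 0) ⟩
    F m - F 0                                  ∎
    where
    open ≡-Reasoning
    solve : ∀ a b c → a - b ≡ a + c - c - b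
    solve = solve-∀
    solve′ : ∀ s a c → s + a - c - s ≡ a - c
    solve′ = solve-∀

  sumBelow-parts : ∀ K (a : ℕ → ℤ) →
    ∑ℕ[ j < K ] (+ j * a (suc j)) ≡ ∑ℕ[ j < K ] (+ j * a j) + + K * a K - ∑ℕ[ j < K ] a (suc j)
  sumBelow-parts K a = begin
    ∑ℕ[ j < K ] (+ j * a (suc j))                  ≡⟨ sumBelow-cong K (λ j → solve (+ j) (a (suc j))) ⟩
    ∑ℕ[ j < K ] (b (suc j) - a (suc j))            ≡⟨ ∑-sub {K} (b ∘ suc ∘ toℕ) (a ∘ suc ∘ toℕ) ⟩
    ∑ℕ[ j < K ] b (suc j) - ∑ℕ[ j < K ] a (suc j)  ≡⟨ cong (_- ∑ℕ[ j < K ] a (suc j)) shifted ⟩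
    ∑ℕ[ j < K ] b j + b K - ∑ℕ[ j < K ] a (suc j)  ∎
    where
    open ≡-Reasoning
    b : ℕ → ℤ
    b j = + j * a j
    solve : ∀ j x → j * x ≡ (+ 1 + j) * x - x
    solve = solve-∀
    shifted : ∑ℕ[ j < K ] b (suc j) ≡ ∑ℕ[ j < K ] b j + b K
    shifted = trans (sym (trans (cong (_+_ (∑ℕ[ j < K ] b (suc j))) (ℤP.*-zeroˡ (a 0))) (ℤP.+-identityʳ _)))
                    (sumBelow-shift K b)

  ∣∑∣≤∑ : ∀ {n} (f : Fin n → ℤ) (B : Fin n → ℕ) → (∀ i → Int.∣ f i ∣ ≤ B i) → Int.∣ sum f ∣ ≤ ℕΣ.sum B
  ∣∑∣≤∑ {zero}  f B f≤B = z≤n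
  ∣∑∣≤∑ {suc n} f B f≤B =
    ℕP.≤-trans (ℤP.∣i+j∣≤∣i∣+∣j∣ (f zero) _) (ℕP.+-mono-≤ (f≤B zero) (∣∑∣≤∑ (f ∘ suc) (B ∘ suc) (f≤B ∘ suc)))

  term≤∑ : ∀ {n} (B : Fin n → ℕ) i → B i ≤ ℕΣ.sum B
  term≤∑ B zero    = ℕP.m≤m+n (B zero) _
  term≤∑ B (suc i) = ℕP.≤-trans (term≤∑ (B ∘ suc) i) (ℕP.m≤n+m _ (B zero))

  ∑∑ : ∀ n (m : Fin n → ℕ) → ((w : Fin n) → Fin (m w) → ℤ) → ℤ
  ∑∑ n m f = ∑[ w < n ] ∑[ a < m w ] f w a

  module ∑∑-Laws {n} {m : Fin n → ℕ} where

    ∑∑-cong : ∀ {f g : (w : Fin n) → Fin (m w) → ℤ} → (∀ w a → f w a ≡ g w a) → ∑∑ n m f ≡ ∑∑ n m g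
    ∑∑-cong f≗g = sum-cong-≗ {n} (λ w → sum-cong-≗ {m w} (f≗g w))

    ∑∑-distrib-+ : ∀ (f g : (w : Fin n) → Fin (m w) → ℤ) → ∑∑ n m (λ w a → f w a + g w a) ≡ ∑∑ n m f + ∑∑ n m g
    ∑∑-distrib-+ f g = trans (sum-cong-≗ {n} (λ w → ∑-distrib-+ {m w} (f w) (g w))) (∑-distrib-+ {n} _ _)

    ∑∑-sub : ∀ (f g : (w : Fin n) → Fin (m w) → ℤ) → ∑∑ n m (λ w a → f w a - g w a) ≡ ∑∑ n m f - ∑∑ n m g
    ∑∑-sub f g = trans (sum-cong-≗ {n} (λ w → ∑-sub {m w} (f w) (g w))) (∑-sub {n} _ _)

    ∑∑-scale : ∀ (c : ℤ) (f : (w : Fin n) → Fin (m w) → ℤ) → ∑∑ n m (λ w a → c * f w a) ≡ c * ∑∑ n m f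
    ∑∑-scale c f = trans (sum-cong-≗ {n} (λ w → sym (*-distribˡ-sum {m w} c (f w)))) (sym (*-distribˡ-sum {n} c _))

    ∑∑-swap : ∀ {k} (f : (w : Fin n) → Fin (m w) → Fin k → ℤ) →
              ∑∑ n m (λ w a → ∑[ b < k ] f w a b) ≡ ∑[ b < k ] ∑∑ n m (λ w a → f w a b)
    ∑∑-swap {k} f = trans (sum-cong-≗ {n} (λ w → ∑-comm {m w} {k} (f w))) (∑-comm {n} {k} _)

open FiniteSums

module Iteration where

  iter : ∀ {A : Set} → (A → A) → ℕ → A → A
  iter f n x = fold x f n

  iter-add : ∀ {A : Set} (f : A → A) m n x → iter f (m ℕ.+ n) x ≡ iter f m (iter f n x)
  iter-add f m n x = fold-+ x f m

  iter-comm : ∀ {A : Set} (f g : A → A) → (∀ x → f (g x) ≡ g (f x)) →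
              ∀ j x → iter f j (g x) ≡ g (iter f j x)
  iter-comm f g fg zero    x = refl
  iter-comm f g fg (suc j) x = trans (cong f (iter-comm f g fg j x)) (fg _)

  iter-mul : ∀ {A : Set} (f : A → A) K → (∀ x → iter f K x ≡ x) → ∀ q x → iter f (q ℕ.* K) x ≡ x
  iter-mul f K period zero    x = refl
  iter-mul f K period (suc q) x =
    trans (iter-add f K (q ℕ.* K) x) (trans (period _) (iter-mul f K period q x))

  iter-surj : ∀ {A : Set} (f : A → A) → (∀ y → ∃ λ x → f x ≡ y) → ∀ m y → ∃ λ x → iter f m x ≡ y
  iter-surj f onto zero    y = y , refl
  iter-surj f onto (suc m) y with onto y
  ... | x₁ , fx₁≡y with iter-surj f onto m x₁
  ...   | x , fᵐx≡x₁ = x , trans (cong f fᵐx≡x₁) fx₁≡y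

  orbit-repeat : ∀ {A : Set} (f : A → A) u a d → iter f (d ℕ.+ a) u ≡ iter f a u →
                 ∀ q e → iter f (q ℕ.* d ℕ.+ (e ℕ.+ a)) u ≡ iter f (e ℕ.+ a) u
  orbit-repeat f u a d loop zero    e = refl
  orbit-repeat f u a d loop (suc q) e = begin
    iter f (d ℕ.+ q ℕ.* d ℕ.+ (e ℕ.+ a)) u       ≡⟨ cong (λ k → iter f k u) (ℕP.+-assoc d (q ℕ.* d) (e ℕ.+ a)) ⟩
    iter f (d ℕ.+ (q ℕ.* d ℕ.+ (e ℕ.+ a))) u     ≡⟨ iter-add f d _ u ⟩
    iter f d (iter f (q ℕ.* d ℕ.+ (e ℕ.+ a)) u)  ≡⟨ cong (iter f d) (orbit-repeat f u a d loop q e) ⟩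
    iter f d (iter f (e ℕ.+ a) u)                ≡⟨ iter-add f d (e ℕ.+ a) u ⟨
    iter f (d ℕ.+ (e ℕ.+ a)) u                   ≡⟨ cong (λ k → iter f k u) swap-front ⟩
    iter f (e ℕ.+ (d ℕ.+ a)) u                   ≡⟨ iter-add f e (d ℕ.+ a) u ⟩
    iter f e (iter f (d ℕ.+ a) u)                ≡⟨ cong (iter f e) loop ⟩
    iter f e (iter f a u)                        ≡⟨ iter-add f e a u ⟨
    iter f (e ℕ.+ a) u                           ∎
    where
    open ≡-Reasoning
    swap-front : d ℕ.+ (e ℕ.+ a) ≡ e ℕ.+ (d ℕ.+ a)
    swap-front = trans (sym (ℕP.+-assoc d e a)) (trans (cong (ℕ._+ a) (ℕP.+-comm d e)) (ℕP.+-assoc e d a))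

  ∣-factorial : ∀ {d n} → 0 < d → d ≤ n → d ∣ n !
  ∣-factorial {suc d} _ d≤n = ∣-trans (m∣m*n (d !)) (m≤n⇒m!∣n! d≤n)

  -- For any self-map of an n-element set, f^(n! + n) = f^n: after n steps
  -- every orbit has entered its cycle, whose length divides n!.
  eventually-periodic : ∀ n (f : Fin n → Fin n) u → iter f (n ! ℕ.+ n) u ≡ iter f n u
  eventually-periodic n f u
    with pigeonhole (ℕP.n<1+n n) (λ (m : Fin (suc n)) → iter f (toℕ m) u)
  ... | i , j , i<j , fⁱu≡fʲu
    with ∣-factorial (ℕP.m<n⇒0<n∸m i<j) (ℕP.≤-trans (ℕP.m∸n≤m (toℕ j) (toℕ i)) (ℕP.≤-pred (toℕ<n j)))
  ... | divides q n!≡qd = begin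
    iter f (n ! ℕ.+ n) u                    ≡⟨ cong (λ k → iter f k u) (cong₂ ℕ._+_ n!≡qd (sym n∸a+a≡n)) ⟩
    iter f (q ℕ.* d ℕ.+ (n ∸ a ℕ.+ a)) u     ≡⟨ orbit-repeat f u a d loop q (n ∸ a) ⟩
    iter f (n ∸ a ℕ.+ a) u                  ≡⟨ cong (λ k → iter f k u) n∸a+a≡n ⟩
    iter f n u                              ∎
    where
    open ≡-Reasoning
    a = toℕ i
    d = toℕ j ∸ a
    n∸a+a≡n : n ∸ a ℕ.+ a ≡ n
    n∸a+a≡n = ℕP.m∸n+n≡m (ℕP.≤-trans (ℕP.<⇒≤ i<j) (ℕP.≤-pred (toℕ<n j)))
    loop : iter f (d ℕ.+ a) u ≡ iter f a u
    loop = trans (cong (λ k → iter f k u) (ℕP.m∸n+n≡m (ℕP.<⇒≤ i<j))) (sym fⁱu≡fʲu)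

  surjection-period : ∀ n (f : Fin n → Fin n) → (∀ y → ∃ λ x → f x ≡ y) → ∀ s → iter f (n !) s ≡ s
  surjection-period n f onto s with iter-surj f onto n s
  ... | u , fⁿu≡s = begin
    iter f (n !) s                 ≡⟨ cong (iter f (n !)) fⁿu≡s ⟨
    iter f (n !) (iter f n u)      ≡⟨ iter-add f (n !) n u ⟨
    iter f (n ! ℕ.+ n) u           ≡⟨ eventually-periodic n f u ⟩
    iter f n u                     ≡⟨ fⁿu≡s ⟩
    s                              ∎
    where open ≡-Reasoning

open Iteration

module Arithmetic where
  open Int using (+_; _*_; _-_; 0ℤ)

  Eventually : (ℕ → Set) → Set
  Eventually P = ∃ λ k₀ → ∀ k → k₀ ≤ k → P k

  eventually-all : ∀ n (P : Fin n → ℕ → Set) → (∀ i → Eventually (P i)) → Eventually (λ k → ∀ i → P i k)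
  eventually-all zero    P ev = 0 , λ k _ ()
  eventually-all (suc n) P ev with ev zero | eventually-all n (P ∘ suc) (ev ∘ suc)
  ... | k₁ , P₀ | k₂ , Pₛ = k₁ ℕ.⊔ k₂ , λ where
    k k₁⊔k₂≤k zero    → P₀ k (ℕP.≤-trans (ℕP.m≤m⊔n k₁ k₂) k₁⊔k₂≤k)
    k k₁⊔k₂≤k (suc i) → Pₛ k (ℕP.≤-trans (ℕP.m≤n⊔m k₁ k₂) k₁⊔k₂≤k) i

  bounded-multiples : ∀ (d : ℤ) B → (∀ m → Int.∣ d * + m ∣ ≤ B) → d ≡ 0ℤ
  bounded-multiples d B bounded = ℤP.∣i∣≡0⇒i≡0 (ℕP.n<1⇒n≡0 (ℕP.*-cancelʳ-< (suc B) Int.∣ d ∣ 1 ∣d∣*[1+B]<1+B))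
    where
    ∣d∣*[1+B]<1+B : Int.∣ d ∣ ℕ.* suc B < 1 ℕ.* suc B
    ∣d∣*[1+B]<1+B = ℕP.≤-<-trans (subst (_≤ B) (ℤP.∣i*j∣≡∣i∣*∣j∣ d (+ suc B)) (bounded (suc B)))
                                (subst (B <_) (sym (ℕP.*-identityˡ (suc B))) (ℕP.n<1+n B))

  -- K + 1 divides no power of K, for K > 0, being coprime to K and > 1.
  suc-∤-power : ∀ K → 0 < K → ∀ e → ¬ (suc K ∣ K ℕ.^ e)
  suc-∤-power K 0<K zero    1+K∣1 = ℕP.<⇒≢ (s≤s 0<K) (sym (∣1⇒≡1 1+K∣1))
  suc-∤-power K 0<K (suc e) 1+K∣Kᵉ⁺¹ = suc-∤-power K 0<K e (coprime-divisor coprime 1+K∣Kᵉ⁺¹)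
    where
    coprime : Coprime (suc K) K
    coprime = subst (λ m → Coprime m K) (ℕP.+-comm K 1) (coprime-+ λ (d∣1 , _) → ∣1⇒≡1 d∣1)

  pos-∸ : ∀ {m n} → n ≤ m → + (m ∸ n) ≡ + m - + n
  pos-∸ {m} {n} n≤m = sym (trans (ℤP.m-n≡m⊖n m n) (ℤP.⊖-≥ n≤m))

  toppler-multiple : ∀ p .{{_ : NonZero p}} q m → q < p → toppler p q (m ℕ.* p) ≡ m
  toppler-multiple p q m q<p = trans (+-distrib-/-∣ˡ q (n∣m*n m))
    (trans (cong₂ ℕ._+_ (m*n/n≡m m p) (m<n⇒m/n≡0 q<p)) (ℕP.+-identityʳ m))

open Arithmetic

-- Commuting maps T_i (i < A) of a set Q with T_i^K = id, and an integer
-- cocycle g (g_i s + g_j (T_i s) = g_j s + g_i (T_j s)).  If every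
-- invariant function is constant, g becomes, after scaling by K^(A+1),
-- cohomologous to a constant cocycle: K^A·c_i = K^(A+1)·g_i s + Ψ(T_i s) − Ψ s.
module Straightening {Q : Set} {A : ℕ} (T : Fin A → Q → Q) (K : ℕ)
                     (g : Fin A → Q → ℤ) (s₀ : Q) where
  open Int using (+_; _+_; _*_; _-_; 0ℤ)

  orbitSum : Fin A → Q → ℤ
  orbitSum i s = ∑ℕ[ j < K ] g i (iter (T i) j s)

  -- Its value at the base point; it will turn out not to depend on it.
  cycleTotal : Fin A → ℤ
  cycleTotal i = orbitSum i s₀

  -- The deviation of K·g_i from its orbit mean: a cocycle with zero orbit sums.
  centred : Fin A → Q → ℤ
  centred i s = cycleTotal i - + K * g i s

  -- A solution P of P (T_l s) = P s + K·f s, when f has zero T_l-orbit sums.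
  orbitPotential : Fin A → (Q → ℤ) → Q → ℤ
  orbitPotential l f s = ∑ℕ[ j < K ] (+ j * f (iter (T l) j s))

  -- potential ls trivialises K^|ls|·centred_i for every letter i in ls;
  -- defect l ls is what remains of K^|ls|·centred_l after using potential ls.
  potential : List (Fin A) → Q → ℤ
  defect : Fin A → List (Fin A) → Q → ℤ
  potential []       s = 0ℤ
  potential (l ∷ ls) s = + K * potential ls s + orbitPotential l (defect l ls) s
  defect l ls s = + (K ^ length ls) * centred l s - (potential ls (T l s) - potential ls s)

  Ψ : Q → ℤ
  Ψ = potential (allFin A)

  module Laws
    (commute : ∀ i j s → T i (T j s) ≡ T j (T i s))
    (period : ∀ i s → iter (T i) K s ≡ s)
    (cocycle : ∀ i j s → g i s + g j (T i s) ≡ g j s + g i (T j s))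
    (invariant⇒constant : (f : Q → ℤ) → (∀ i s → f (T i s) ≡ f s) → ∀ s → f s ≡ f s₀)
    where

    iter-T : ∀ l i j s → iter (T l) j (T i s) ≡ T i (iter (T l) j s)
    iter-T l i = iter-comm (T l) (T i) (commute l i)

    ZeroOrbits : Fin A → (Q → ℤ) → Set
    ZeroOrbits l f = ∀ s → ∑ℕ[ j < K ] f (iter (T l) j s) ≡ 0ℤ

    orbitSum-invariant : ∀ i l s → orbitSum i (T l s) ≡ orbitSum i s
    orbitSum-invariant i l s = begin
      orbitSum i (T l s)                           ≡⟨ sumBelow-cong K (λ j → trans (cong (g i) (iter-T i l j s)) (shift (orbit j))) ⟩
      ∑ℕ[ j < K ] (g i (orbit j) + (g l (orbit (suc j)) - g l (orbit j)))
                                                   ≡⟨ ∑-distrib-+ {K} (g i ∘ orbit ∘ toℕ) _ ⟩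
      orbitSum i s + ∑ℕ[ j < K ] (g l (orbit (suc j)) - g l (orbit j))
                                                   ≡⟨ cong (_+_ (orbitSum i s)) (telescope K (g l ∘ orbit)) ⟩
      orbitSum i s + (g l (orbit K) - g l s)       ≡⟨ cong (λ x → orbitSum i s + (g l x - g l s)) (period i s) ⟩
      orbitSum i s + (g l s - g l s)               ≡⟨ solve (orbitSum i s) (g l s) ⟩
      orbitSum i s                                 ∎
      where
      open ≡-Reasoning
      orbit : ℕ → Q
      orbit j = iter (T i) j s
      -- the cocycle identity, solved for g_i (T_l x)
      shift : ∀ x → g i (T l x) ≡ g i x + (g l (T i x) - g l x)
      shift x = trans (solve₁ (g i (T l x)) (g l x)) (trans (cong (_- g l x) (cocycle l i x)) (solve₂ (g i x) (g l (T i x)) (g l x)))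
        where solve₁ : ∀ a b → a ≡ b + a - b
              solve₁ = solve-∀
              solve₂ : ∀ a b c → a + b - c ≡ a + (b - c)
              solve₂ = solve-∀
      solve : ∀ a b → a + (b - b) ≡ a
      solve = solve-∀

    orbitSum-constant : ∀ i s → orbitSum i s ≡ cycleTotal i
    orbitSum-constant i = invariant⇒constant (orbitSum i) (λ l s → orbitSum-invariant i l s)

    centred-orbits : ∀ i → ZeroOrbits i (centred i)
    centred-orbits i s = begin
      ∑ℕ[ j < K ] (cycleTotal i - + K * g i (iter (T i) j s))
                                              ≡⟨ ∑-sub {K} (λ _ → cycleTotal i) (λ j → + K * g i (iter (T i) (toℕ j) s)) ⟩
      ∑ℕ[ j < K ] cycleTotal i - ∑ℕ[ j < K ] (+ K * g i (iter (T i) j s))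
                                              ≡⟨ cong₂ _-_ (sumBelow-const K (cycleTotal i)) (sym (*-distribˡ-sum {K} (+ K) (λ j → g i (iter (T i) (toℕ j) s)))) ⟩
      + K * cycleTotal i - + K * orbitSum i s ≡⟨ cong (λ x → + K * cycleTotal i - + K * x) (orbitSum-constant i s) ⟩
      + K * cycleTotal i - + K * cycleTotal i ≡⟨ ℤP.+-inverseʳ (+ K * cycleTotal i) ⟩
      0ℤ                                      ∎
      where open ≡-Reasoning

    centred-cocycle : ∀ i j s → centred i s + centred j (T i s) ≡ centred j s + centred i (T j s)
    centred-cocycle i j s = begin
      centred i s + centred j (T i s)              ≡⟨ regroup (cycleTotal i) (cycleTotal j) (+ K) (g i s) (g j (T i s)) ⟩
      cᵢ + cⱼ - + K * (g i s + g j (T i s))        ≡⟨ cong (λ x → cᵢ + cⱼ - + K * x) (cocycle i j s) ⟩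
      cᵢ + cⱼ - + K * (g j s + g i (T j s))        ≡⟨ regroup′ (cycleTotal i) (cycleTotal j) (+ K) (g j s) (g i (T j s)) ⟩
      centred j s + centred i (T j s)              ∎
      where
      open ≡-Reasoning
      cᵢ = cycleTotal i
      cⱼ = cycleTotal j
      regroup : ∀ ca cb k a b → ca - k * a + (cb - k * b) ≡ ca + cb - k * (a + b)
      regroup = solve-∀
      regroup′ : ∀ ca cb k a b → ca + cb - k * (a + b) ≡ cb - k * a + (ca - k * b)
      regroup′ = solve-∀

    orbitPotential-step : ∀ l f → ZeroOrbits l f → ∀ s →
                          orbitPotential l f (T l s) ≡ orbitPotential l f s + + K * f s
    orbitPotential-step l f zero-orbits s = begin
      orbitPotential l f (T l s)                 ≡⟨ sumBelow-cong K (λ j → cong (λ x → + j * f x) (iter-T l l j s)) ⟩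
      ∑ℕ[ j < K ] (+ j * a (suc j))              ≡⟨ sumBelow-parts K a ⟩
      P + + K * a K - ∑ℕ[ j < K ] a (suc j)      ≡⟨ cong₂ (λ x y → P + + K * f x - y) (period l s) tail-zero ⟩
      P + + K * f s - 0ℤ                         ≡⟨ ℤP.+-identityʳ _ ⟩
      P + + K * f s                              ∎
      where
      open ≡-Reasoning
      P = orbitPotential l f s
      a : ℕ → ℤ
      a j = f (iter (T l) j s)
      tail-zero : ∑ℕ[ j < K ] a (suc j) ≡ 0ℤ
      tail-zero = trans (sumBelow-cong K (λ j → cong f (sym (iter-T l l j s)))) (zero-orbits (T l s))

    orbitPotential-invariant : ∀ l f i → (∀ s → f (T i s) ≡ f s) →
                               ∀ s → orbitPotential l f (T i s) ≡ orbitPotential l f s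
    orbitPotential-invariant l f i invariant s =
      sumBelow-cong K (λ j → cong (λ x → + j * x) (trans (cong f (iter-T l i j s)) (invariant _)))

    Balanced : List (Fin A) → Set
    Balanced ls = ∀ i → i ∈ ls → ∀ s → potential ls (T i s) ≡ potential ls s + + (K ^ length ls) * centred i s

    -- The defect can be trivialised along T_l without disturbing the letters of ls.
    defect-orbits : ∀ l ls → ZeroOrbits l (defect l ls)
    defect-orbits l ls s = begin
      ∑ℕ[ j < K ] (E * centred l (orbit j) - (Φ (orbit (suc j)) - Φ (orbit j)))
                                    ≡⟨ ∑-sub {K} (λ j → E * centred l (orbit (toℕ j))) _ ⟩
      ∑ℕ[ j < K ] (E * centred l (orbit j)) - ∑ℕ[ j < K ] (Φ (orbit (suc j)) - Φ (orbit j))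
                                    ≡⟨ cong₂ _-_ (sym (*-distribˡ-sum {K} E (centred l ∘ orbit ∘ toℕ))) (telescope K (Φ ∘ orbit)) ⟩
      E * ∑ℕ[ j < K ] centred l (orbit j) - (Φ (orbit K) - Φ s)
                                    ≡⟨ cong₂ (λ x y → E * x - (Φ y - Φ s)) (centred-orbits l s) (period l s) ⟩
      E * 0ℤ - (Φ s - Φ s)          ≡⟨ solve E (Φ s) ⟩
      0ℤ                            ∎
      where
      open ≡-Reasoning
      Φ = potential ls
      E = + (K ^ length ls)
      orbit : ℕ → Q
      orbit j = iter (T l) j s
      solve : ∀ e x → e * 0ℤ - (x - x) ≡ 0ℤ
      solve = solve-∀

    defect-invariant : ∀ l ls → Balanced ls → ∀ i → i ∈ ls → ∀ s → defect l ls (T i s) ≡ defect l ls s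
    defect-invariant l ls balanced-ls i i∈ls s = begin
      E * centred l (T i s) - (Φ (T l (T i s)) - Φ (T i s))
               ≡⟨ cong (λ x → E * centred l (T i s) - (Φ x - Φ (T i s))) (commute l i s) ⟩
      E * centred l (T i s) - (Φ (T i (T l s)) - Φ (T i s))
               ≡⟨ cong₂ (λ x y → E * centred l (T i s) - (x - y)) (balanced-ls i i∈ls (T l s)) (balanced-ls i i∈ls s) ⟩
      E * centred l (T i s) - (Φ (T l s) + E * centred i (T l s) - (Φ s + E * centred i s))
               ≡⟨ regroup E (centred l (T i s)) (Φ (T l s)) (centred i (T l s)) (Φ s) (centred i s) ⟩
      E * (centred i s + centred l (T i s) - centred i (T l s)) - (Φ (T l s) - Φ s)
               ≡⟨ cong (λ x → E * (x - centred i (T l s)) - (Φ (T l s) - Φ s)) (centred-cocycle i l s) ⟩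
      E * (centred l s + centred i (T l s) - centred i (T l s)) - (Φ (T l s) - Φ s)
               ≡⟨ cancel E (centred l s) (centred i (T l s)) (Φ (T l s) - Φ s) ⟩
      E * centred l s - (Φ (T l s) - Φ s)
               ∎
      where
      open ≡-Reasoning
      Φ = potential ls
      E = + (K ^ length ls)
      regroup : ∀ e a b c d f → e * a - (b + e * c - (d + e * f)) ≡ e * (f + a - c) - (b - d)
      regroup = solve-∀
      cancel : ∀ e a c x → e * (a + c - c) - x ≡ e * a - x
      cancel = solve-∀

    balanced : ∀ ls → Balanced ls
    balanced (l ∷ ls) ._ (Any.here refl) s = begin
      + K * Φ (T l s) + P (T l s)
               ≡⟨ cong (_+_ (+ K * Φ (T l s))) (orbitPotential-step l (defect l ls) (defect-orbits l ls) s) ⟩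
      + K * Φ (T l s) + (P s + + K * (E * centred l s - (Φ (T l s) - Φ s)))
               ≡⟨ regroup (+ K) (Φ (T l s)) (P s) E (centred l s) (Φ s) ⟩
      + K * Φ s + P s + + K * E * centred l s
               ≡⟨ cong (λ x → + K * Φ s + P s + x * centred l s) (sym (ℤP.pos-* K (K ^ length ls))) ⟩
      + K * Φ s + P s + + (K ^ suc (length ls)) * centred l s
               ∎
      where
      open ≡-Reasoning
      Φ = potential ls
      P = orbitPotential l (defect l ls)
      E = + (K ^ length ls)
      regroup : ∀ k a p e c b → k * a + (p + k * (e * c - (a - b))) ≡ k * b + p + k * e * c
      regroup = solve-∀
    balanced (l ∷ ls) i (Any.there i∈ls) s = begin
      + K * Φ (T i s) + P (T i s)
               ≡⟨ cong₂ (λ x y → + K * x + y) (balanced ls i i∈ls s)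
                        (orbitPotential-invariant l (defect l ls) i (defect-invariant l ls (balanced ls) i i∈ls) s) ⟩
      + K * (Φ s + E * centred i s) + P s
               ≡⟨ regroup (+ K) (Φ s) E (centred i s) (P s) ⟩
      + K * Φ s + P s + + K * E * centred i s
               ≡⟨ cong (λ x → + K * Φ s + P s + x * centred i s) (sym (ℤP.pos-* K (K ^ length ls))) ⟩
      + K * Φ s + P s + + (K ^ suc (length ls)) * centred i s
               ∎
      where
      open ≡-Reasoning
      Φ = potential ls
      P = orbitPotential l (defect l ls)
      E = + (K ^ length ls)
      regroup : ∀ k a e c p → k * (a + e * c) + p ≡ k * a + p + k * e * c
      regroup = solve-∀

    straighten : ∀ i s → + (K ^ A) * cycleTotal i ≡ + (K ^ suc A) * g i s + (Ψ (T i s) - Ψ s)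
    straighten i s = begin
      + (K ^ A) * cycleTotal i
               ≡⟨ regroup (+ K) (+ (K ^ A)) (cycleTotal i) (g i s) (Ψ s) ⟩
      + K * + (K ^ A) * g i s + (Ψ s + + (K ^ A) * centred i s - Ψ s)
               ≡⟨ cong₂ (λ x y → x * g i s + (Ψ s + + (K ^ y) * centred i s - Ψ s))
                        (sym (ℤP.pos-* K (K ^ A))) (sym (length-tabulate {n = A} id)) ⟩
      + (K ^ suc A) * g i s + (Ψ s + + (K ^ length (allFin A)) * centred i s - Ψ s)
               ≡⟨ cong (λ x → + (K ^ suc A) * g i s + (x - Ψ s)) (balanced (allFin A) i (∈-allFin i) s) ⟨
      + (K ^ suc A) * g i s + (Ψ (T i s) - Ψ s)
               ∎
      where
      open ≡-Reasoning
      regroup : ∀ k e c x y → e * c ≡ k * e * x + (y + e * (c - k * x) - y)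
      regroup = solve-∀

module Processors where
  open Int using (+_; _+_; _*_; _-_)

  emitted : (P : Processor) → (Fin (nB P) → ℤ) → Fin (nA P) → Fin (nQ P) → ℤ
  emitted P U i s = ∑[ b < nB P ] (+ o P i s b * U b)

  emitted-cocycle : ∀ P → IsAbelian P → ∀ U i j s →
    emitted P U i s + emitted P U j (t P i s) ≡ emitted P U j s + emitted P U i (t P j s)
  emitted-cocycle P (_ , outputs-commute) U i j s = begin
    emitted P U i s + emitted P U j (t P i s)
         ≡⟨ ∑-distrib-+ {nB P} (λ b → + o P i s b * U b) _ ⟨
    ∑[ b < nB P ] (+ o P i s b * U b + + o P j (t P i s) b * U b)
         ≡⟨ sum-cong-≗ {nB P} (λ b → lift (o P i s b) (o P j (t P i s) b) (o P j s b) (o P i (t P j s) b) (U b)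
                                           (outputs-commute i j s b)) ⟩
    ∑[ b < nB P ] (+ o P j s b * U b + + o P i (t P j s) b * U b)
         ≡⟨ ∑-distrib-+ {nB P} (λ b → + o P j s b * U b) _ ⟩
    emitted P U j s + emitted P U i (t P j s)
         ∎
    where
    open ≡-Reasoning
    lift : ∀ m n m′ n′ u → m ℕ.+ n ≡ m′ ℕ.+ n′ → + m * u + + n * u ≡ + m′ * u + + n′ * u
    lift m n m′ n′ u eq = begin
      + m * u + + n * u     ≡⟨ ℤP.*-distribʳ-+ u (+ m) (+ n) ⟨
      (+ m + + n) * u       ≡⟨ cong (_* u) (trans (sym (ℤP.pos-+ m n)) (trans (cong +_ eq) (ℤP.pos-+ m′ n′))) ⟩
      (+ m′ + + n′) * u     ≡⟨ ℤP.*-distribʳ-+ u (+ m′) (+ n′) ⟩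
      + m′ * u + + n′ * u   ∎

  emitted-scale : ∀ P (C : ℤ) (U V : Fin (nB P) → ℤ) → (∀ b → V b ≡ C * U b) →
                  ∀ i s → emitted P V i s ≡ C * emitted P U i s
  emitted-scale P C U V V≡CU i s = begin
    ∑[ b < nB P ] (+ o P i s b * V b)        ≡⟨ sum-cong-≗ {nB P} (λ b → trans (cong (+ o P i s b *_) (V≡CU b)) (swap (+ o P i s b) C (U b))) ⟩
    ∑[ b < nB P ] (C * (+ o P i s b * U b))  ≡⟨ *-distribˡ-sum {nB P} C (λ b → + o P i s b * U b) ⟨
    C * emitted P U i s                      ∎
    where
    open ≡-Reasoning
    swap : ∀ x c u → x * (c * u) ≡ c * (x * u)
    swap = solve-∀

  run-comm : ∀ P → IsAbelian P → ∀ i w s → run P w (t P i s) ≡ t P i (run P w s)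
  run-comm P ab i []      s = refl
  run-comm P ab i (x ∷ w) s = trans (cong (run P w) (proj₁ ab x i s)) (run-comm P ab i w (t P x s))

  recurrent⇒constant : ∀ P → IsRecurrent P → (f : Fin (nQ P) → ℤ) →
                       (∀ i s → f (t P i s) ≡ f s) → ∀ s → f s ≡ f (q₀ P)
  recurrent⇒constant P recurrent f invariant s with recurrent (q₀ P) s
  ... | w , run-w≡s = trans (cong f (sym run-w≡s)) (along w (q₀ P))
    where
    along : ∀ w s → f (run P w s) ≡ f s
    along []      s = refl
    along (x ∷ w) s = trans (along w (t P x s)) (invariant x s)

  -- The transitions of an abelian recurrent processor are surjective, hence
  -- permutations of its nQ states, so their (nQ !)-th power is the identity.
  transition-period : ∀ P → IsAbelian P → IsRecurrent P → ∀ i s → iter (t P i) (nQ P !) s ≡ s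
  transition-period P ab recurrent i = surjection-period (nQ P) (t P i) onto
    where
    onto : ∀ s → ∃ λ u → t P i u ≡ s
    onto s with recurrent (t P i s) s
    ... | w , run-w≡s = run P w s , trans (sym (run-comm P ab i w s)) run-w≡s

  -- The exponent M ≥ nA P is common to
  -- all processors of a network.
  module ProcessorWeights (P : Processor) (K : ℕ) (U : Fin (nB P) → ℤ) where
    open Straightening (t P) K (emitted P U) (q₀ P) using (cycleTotal; Ψ)

    inputWeight : ℕ → Fin (nA P) → ℤ
    inputWeight M i = + (K ^ M) * cycleTotal i

    statePotential : ℕ → Fin (nQ P) → ℤ
    statePotential M s = + (K ^ (M ∸ nA P)) * Ψ s

    weight-balance : IsAbelian P → IsRecurrent P → (∀ i s → iter (t P i) K s ≡ s) →
      ∀ M → nA P ≤ M → ∀ i s →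
      inputWeight M i ≡ + (K ^ suc M) * emitted P U i s + (statePotential M (t P i s) - statePotential M s)
    weight-balance ab recurrent period M A≤M i s = begin
      + (K ^ M) * cycleTotal i
          ≡⟨ cong (_* cycleTotal i) F*Kᴬ≡Kᴹ ⟨
      F * + (K ^ A) * cycleTotal i
          ≡⟨ trans (ℤP.*-assoc F _ _) (cong (F *_) (straighten i s)) ⟩
      F * (+ (K ^ suc A) * emitted P U i s + (Ψ (t P i s) - Ψ s))
          ≡⟨ cong (λ x → F * (x * emitted P U i s + (Ψ (t P i s) - Ψ s))) (ℤP.pos-* K (K ^ A)) ⟩
      F * (+ K * + (K ^ A) * emitted P U i s + (Ψ (t P i s) - Ψ s))
          ≡⟨ regroup F (+ K) (+ (K ^ A)) (emitted P U i s) (Ψ (t P i s)) (Ψ s) ⟩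
      + K * (F * + (K ^ A)) * emitted P U i s + (F * Ψ (t P i s) - F * Ψ s)
          ≡⟨ cong (λ x → + K * x * emitted P U i s + (F * Ψ (t P i s) - F * Ψ s)) F*Kᴬ≡Kᴹ ⟩
      + K * + (K ^ M) * emitted P U i s + (F * Ψ (t P i s) - F * Ψ s)
          ≡⟨ cong (λ x → x * emitted P U i s + (F * Ψ (t P i s) - F * Ψ s)) (ℤP.pos-* K (K ^ M)) ⟨
      + (K ^ suc M) * emitted P U i s + (F * Ψ (t P i s) - F * Ψ s)
          ∎
      where
      open ≡-Reasoning
      open Straightening.Laws (t P) K (emitted P U) (q₀ P)
        (proj₁ ab) period (emitted-cocycle P ab U) (recurrent⇒constant P recurrent)
      A = nA P
      F = + (K ^ (M ∸ A))
      F*Kᴬ≡Kᴹ : F * + (K ^ A) ≡ + (K ^ M)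
      F*Kᴬ≡Kᴹ = trans (sym (ℤP.pos-* (K ^ (M ∸ A)) (K ^ A)))
                      (cong +_ (trans (sym (ℕP.^-distribˡ-+-* K (M ∸ A) A)) (cong (K ^_) (ℕP.m∸n+n≡m A≤M))))
      regroup : ∀ f k e g x y → f * (k * e * g + (x - y)) ≡ k * (f * e) * g + (f * x - f * y)
      regroup = solve-∀

  inputWeight-scale : ∀ P K M (C : ℤ) (U V : Fin (nB P) → ℤ) → (∀ b → V b ≡ C * U b) →
    ∀ i → ProcessorWeights.inputWeight P K V M i ≡ C * ProcessorWeights.inputWeight P K U M i
  inputWeight-scale P K M C U V V≡CU i = begin
    + (K ^ M) * ∑ℕ[ j < K ] emitted P V i (orbit j)          ≡⟨ cong (+ (K ^ M) *_) (sumBelow-cong K (λ j → emitted-scale P C U V V≡CU i (orbit j))) ⟩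
    + (K ^ M) * ∑ℕ[ j < K ] (C * emitted P U i (orbit j))    ≡⟨ cong (+ (K ^ M) *_) (*-distribˡ-sum {K} C (λ j → emitted P U i (orbit (toℕ j)))) ⟨
    + (K ^ M) * (C * ∑ℕ[ j < K ] emitted P U i (orbit j))    ≡⟨ swap (+ (K ^ M)) C _ ⟩
    C * (+ (K ^ M) * ∑ℕ[ j < K ] emitted P U i (orbit j))    ∎
    where
    open ≡-Reasoning
    orbit : ℕ → Fin (nQ P)
    orbit j = iter (t P i) j (q₀ P)
    swap : ∀ x c u → x * (c * u) ≡ c * (x * u)
    swap = solve-∀

open Processors

commonPeriod : List Processor → ℕ
commonPeriod L = product (map (λ P → nQ P !) L)

commonPeriod-pos : ∀ L → 0 < commonPeriod L
commonPeriod-pos L = ℕ.>-nonZero⁻¹ _ {{product≢0 (map⁺ (universal (λ P → nQ P ℕP.!≢0) L))}}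

commonPeriod-period : ∀ L i → IsAbelian (lookup L i) → IsRecurrent (lookup L i) →
  ∀ a s → iter (t (lookup L i) a) (commonPeriod L) s ≡ s
commonPeriod-period L i ab recurrent a s with ∈⇒∣product (∈-map⁺ (λ P → nQ P !) (∈-lookup {xs = L} i))
... | divides q period≡q*nQ! =
  trans (cong (λ k → iter (t P a) k s) period≡q*nQ!)
        (iter-mul (t P a) (nQ P !) (transition-period P ab recurrent a) q s)
  where P = lookup L i

inputBound : List Processor → ℕ
inputBound []      = 0
inputBound (P ∷ L) = nA P ℕ.+ inputBound L

inputBound-≥ : ∀ L i → nA (lookup L i) ≤ inputBound L
inputBound-≥ (P ∷ L) zero    = ℕP.m≤m+n (nA P) (inputBound L)
inputBound-≥ (P ∷ L) (suc i) = ℕP.≤-trans (inputBound-≥ L i) (ℕP.m≤n+m (inputBound L) (nA P))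

Valid : Processor → Set
Valid P = IsAbelian P × IsRecurrent P × AllReachable P

-- Weights for the ports of an acyclic network: every letter waiting at
-- an input port of node v is worth weight v a, every letter on the output
-- edge outputWeight, and node v in state q carries potential v q.  They arise as the
-- eventual behaviour of an iteration pulling weights back from the output
-- edge through the processors, which stabilises up to a factor C because
-- the network is acyclic.
module NetworkWeights {L : List Processor} (valid : All Valid L) (N : Net L) (acyclic : Acyclic N) where
  open Int using (+_; _+_; _*_; _-_; 0ℤ)
  open Net N

  K M C : ℕ
  K = commonPeriod L
  M = inputBound L
  C = K ^ suc M

  abelian : ∀ v → IsAbelian (Pr v)
  abelian v = proj₁ (All.lookup valid (∈-lookup (kind v)))

  recurrent : ∀ v → IsRecurrent (Pr v)
  recurrent v = proj₁ (proj₂ (All.lookup valid (∈-lookup (kind v))))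

  period : ∀ v a s → iter (t (Pr v) a) K s ≡ s
  period v = commonPeriod-period L (kind v) (abelian v) (recurrent v)

  ∑ports : ((w : Fin n) → Fin (nA (Pr w)) → ℤ) → ℤ
  ∑ports = ∑∑ n (nA ∘ Pr)

  open ∑∑-Laws {n} {nA ∘ Pr}

  feeds : (v : Fin n) → Fin (nB (Pr v)) → Src → ℤ
  feeds v b (inj₁ _) = 0ℤ
  feeds v b (inj₂ (u , b′)) with u ≟ v
  ... | no _ = 0ℤ
  ... | yes refl with b′ ≟ b
  ...   | yes _ = + 1
  ...   | no _ = 0ℤ

  outWeight : ℕ → ℤ
  outWeight k = + (C ^ k)

  inWeight : ℕ → (v : Fin n) → Fin (nA (Pr v)) → ℤ
  edgeWeight : ℕ → (v : Fin n) → Fin (nB (Pr v)) → ℤ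
  edgeWeight k v b = ∑ports (λ w a → inWeight k w a * feeds v b (src w a)) + outWeight k * feeds v b outSrc
  inWeight zero    v a = 0ℤ
  inWeight (suc k) v a = ProcessorWeights.inputWeight (Pr v) K (edgeWeight k v) M a

  Scales : Fin n → ℕ → Set
  Scales v k = ∀ a → inWeight (suc k) v a ≡ + C * inWeight k v a

  PortScales : (v : Fin n) → ℕ → (w : Fin n) → Fin (nA (Pr w)) → Set
  PortScales v k w a = ∀ b → inWeight (suc k) w a * feeds v b (src w a) ≡ + C * (inWeight k w a * feeds v b (src w a))

  scales-times : ∀ w k → Scales w k → ∀ a x → inWeight (suc k) w a * x ≡ + C * (inWeight k w a * x)
  scales-times w k w-scales a x = trans (cong (_* x) (w-scales a)) (ℤP.*-assoc (+ C) (inWeight k w a) x)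

  edgeWeight-scale : ∀ k v → (∀ w a → PortScales v k w a) → ∀ b → edgeWeight (suc k) v b ≡ + C * edgeWeight k v b
  edgeWeight-scale k v ports-scale b = begin
    ∑ports (λ w a → inWeight (suc k) w a * feeds v b (src w a)) + outWeight (suc k) * feeds v b outSrc
         ≡⟨ cong₂ _+_ (∑∑-cong (λ w a → ports-scale w a b)) (cong (_* feeds v b outSrc) (ℤP.pos-* C (C ^ k))) ⟩
    ∑ports (λ w a → + C * (inWeight k w a * feeds v b (src w a))) + + C * outWeight k * feeds v b outSrc
         ≡⟨ cong₂ _+_ (∑∑-scale (+ C) _) (ℤP.*-assoc (+ C) (outWeight k) _) ⟩
    + C * ∑ports (λ w a → inWeight k w a * feeds v b (src w a)) + + C * (outWeight k * feeds v b outSrc)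
         ≡⟨ ℤP.*-distribˡ-+ (+ C) _ _ ⟨
    + C * edgeWeight k v b
         ∎
    where open ≡-Reasoning

  Downstream : Fin n → Fin n → Set
  Downstream = TransClosure (Adj N)

  downstream-wellFounded : WellFounded (flip Downstream)
  downstream-wellFounded = spo-noetherian record
    { isEquivalence = isEquivalence
    ; irrefl        = λ { refl cycle → acyclic _ cycle }
    ; trans         = _++_
    ; <-resp-≈      = (λ { refl r → r }) , (λ { refl r → r })
    }

  -- Every node eventually scales, once all nodes downstream of it do.
  stabilises : ∀ v → Acc (flip Downstream) v → Eventually (Scales v)
  stabilises v (acc downstream) with
    eventually-all n (λ w k → ∀ a → PortScales v k w a)
      (λ w → eventually-all (nA (Pr w)) (λ a k → PortScales v k w a) (port-scales w))
    where
    vanishes : ∀ x y → x * 0ℤ ≡ + C * (y * 0ℤ)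
    vanishes x y = solve (+ C) x y
      where solve : ∀ c x y → x * 0ℤ ≡ c * (y * 0ℤ)
            solve = solve-∀
    -- a port fed by v lies downstream of v; other ports contribute nothing
    port-scales : ∀ w a → Eventually (λ k → PortScales v k w a)
    port-scales w a with src w a in src≡
    ... | inj₁ _ = 0 , λ k _ b → vanishes (inWeight (suc k) w a) (inWeight k w a)
    ... | inj₂ (u , b′) with u ≟ v
    ...   | no _ = 0 , λ k _ b → vanishes (inWeight (suc k) w a) (inWeight k w a)
    ...   | yes refl with stabilises w (downstream [ a , b′ , src≡ ])
    ...     | k₀ , w-scales = k₀ , λ k k₀≤k b → scales-times w k (w-scales k k₀≤k) a _
  ... | k₀ , ports-scale = suc k₀ , λ where
    (suc k) (s≤s k₀≤k) → inputWeight-scale (Pr v) K M (+ C) (edgeWeight k v) (edgeWeight (suc k) v)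
                            (edgeWeight-scale k v (ports-scale k k₀≤k))

  stabilisation : Eventually (λ k → ∀ v → Scales v k)
  stabilisation = eventually-all n (λ v → Scales v) (λ v → stabilises v (downstream-wellFounded v))

  stage : ℕ
  stage = proj₁ stabilisation

  weight : (v : Fin n) → Fin (nA (Pr v)) → ℤ
  weight = inWeight (suc stage)

  outputWeight : ℤ
  outputWeight = outWeight (suc stage)

  potential : (v : Fin n) → Fin (nQ (Pr v)) → ℤ
  potential v = ProcessorWeights.statePotential (Pr v) K (edgeWeight stage v) M

  balance : ∀ v a q → weight v a ≡
    emitted (Pr v) (edgeWeight (suc stage) v) a q + (potential v (t (Pr v) a q) - potential v q)
  balance v a q = begin
    weight v a
        ≡⟨ ProcessorWeights.weight-balance (Pr v) K (edgeWeight stage v) (abelian v) (recurrent v) (period v)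
             M (inputBound-≥ L (kind v)) a q ⟩
    + C * emitted (Pr v) (edgeWeight stage v) a q + Δ
        ≡⟨ cong (_+ Δ) (emitted-scale (Pr v) (+ C) (edgeWeight stage v) (edgeWeight (suc stage) v) edges-scale a q) ⟨
    emitted (Pr v) (edgeWeight (suc stage) v) a q + Δ
        ∎
    where
    open ≡-Reasoning
    Δ = potential v (t (Pr v) a q) - potential v q
    edges-scale : ∀ b → edgeWeight (suc stage) v b ≡ + C * edgeWeight stage v b
    edges-scale = edgeWeight-scale stage v (λ w a′ b → scales-times w stage (proj₂ stabilisation stage ℕP.≤-refl w) a′ _)

module Conservation {L : List Processor} (valid : All Valid L) (N : Net L) (acyclic : Acyclic N) where
  open Int using (+_; _+_; _*_; _-_; 0ℤ)
  open Net N
  open NetworkWeights valid N acyclic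
  open ∑∑-Laws {n} {nA ∘ Pr}

  totalPotential : ((w : Fin n) → Fin (nQ (Pr w))) → ℤ
  totalPotential σ = ∑[ w < n ] potential w (σ w)

  value : Config N → ℤ
  value c = ∑ports (λ w a → weight w a * + cnt c w a) + outputWeight * + out c + totalPotential (state c)

  here-self : ∀ v a → here N v a v a ≡ 1
  here-self v a with v ≟ v
  ... | no v≢v = ⊥-elim (v≢v refl)
  ... | yes refl with a ≟ a
  ...   | yes _   = refl
  ...   | no a≢a = ⊥-elim (a≢a refl)

  here-other-port : ∀ v a a′ → a′ ≢ a → here N v a v a′ ≡ 0
  here-other-port v a a′ a′≢a with v ≟ v
  ... | no _ = refl
  ... | yes refl with a′ ≟ a
  ...   | yes a′≡a = ⊥-elim (a′≢a a′≡a)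
  ...   | no _     = refl

  here-other-node : ∀ v a w a′ → w ≢ v → here N v a w a′ ≡ 0
  here-other-node v a w a′ w≢v with w ≟ v
  ... | yes w≡v = ⊥-elim (w≢v w≡v)
  ... | no _    = refl

  here≤cnt : ∀ (c : Config N) v a → 0 < cnt c v a → ∀ w a′ → here N v a w a′ ≤ cnt c w a′
  here≤cnt c v a pos w a′ with w ≟ v
  ... | no _ = z≤n
  ... | yes refl with a′ ≟ a
  ...   | yes refl = pos
  ...   | no _     = z≤n

  newState-self : ∀ v a c → newState N v a c v ≡ t (Pr v) a (state c v)
  newState-self v a c with v ≟ v
  ... | no v≢v = ⊥-elim (v≢v refl)
  ... | yes refl = refl

  newState-other : ∀ v a c w → w ≢ v → newState N v a c w ≡ state c w
  newState-other v a c w w≢v with w ≟ v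
  ... | yes w≡v = ⊥-elim (w≢v w≡v)
  ... | no _    = refl

  feeds-self : ∀ v b → feeds v b (inj₂ (v , b)) ≡ + 1
  feeds-self v b with v ≟ v
  ... | no v≢v = ⊥-elim (v≢v refl)
  ... | yes refl with b ≟ b
  ...   | yes _   = refl
  ...   | no b≢b = ⊥-elim (b≢b refl)

  feeds-other-output : ∀ v b b′ → b′ ≢ b → feeds v b (inj₂ (v , b′)) ≡ 0ℤ
  feeds-other-output v b b′ b′≢b with v ≟ v
  ... | no _ = refl
  ... | yes refl with b′ ≟ b
  ...   | yes b′≡b = ⊥-elim (b′≢b b′≡b)
  ...   | no _     = refl

  feeds-other-node : ∀ v b u b′ → u ≢ v → feeds v b (inj₂ (u , b′)) ≡ 0ℤ
  feeds-other-node v b u b′ u≢v with u ≟ v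
  ... | yes u≡v = ⊥-elim (u≢v u≡v)
  ... | no _    = refl

  contrib-self : ∀ v a q b → contrib N v a q (inj₂ (v , b)) ≡ o (Pr v) a q b
  contrib-self v a q b with v ≟ v
  ... | no v≢v = ⊥-elim (v≢v refl)
  ... | yes refl = refl

  contrib-other-node : ∀ v a q u b → u ≢ v → contrib N v a q (inj₂ (u , b)) ≡ 0
  contrib-other-node v a q u b u≢v with u ≟ v
  ... | yes u≡v = ⊥-elim (u≢v u≡v)
  ... | no _    = refl

  ∑ports-here : ∀ (f : (w : Fin n) → Fin (nA (Pr w)) → ℤ) v a →
                ∑ports (λ w a′ → f w a′ * + here N v a w a′) ≡ f v a
  ∑ports-here f v a = begin
    ∑ports (λ w a′ → f w a′ * + here N v a w a′)
         ≡⟨ ∑-δ (λ w → ∑[ a′ < nA (Pr w) ] (f w a′ * + here N v a w a′)) v other-nodes ⟩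
    ∑[ a′ < nA (Pr v) ] (f v a′ * + here N v a v a′)
         ≡⟨ ∑-δ (λ a′ → f v a′ * + here N v a v a′) a other-ports ⟩
    f v a * + here N v a v a   ≡⟨ cong (λ h → f v a * + h) (here-self v a) ⟩
    f v a * + 1                ≡⟨ ℤP.*-identityʳ (f v a) ⟩
    f v a                      ∎
    where
    open ≡-Reasoning
    other-nodes : ∀ w → w ≢ v → ∑[ a′ < nA (Pr w) ] (f w a′ * + here N v a w a′) ≡ 0ℤ
    other-nodes w w≢v = ∑-zero _ (λ a′ → trans (cong (λ h → f w a′ * + h) (here-other-node v a w a′ w≢v)) (ℤP.*-zeroʳ (f w a′)))
    other-ports : ∀ a′ → a′ ≢ a → f v a′ * + here N v a v a′ ≡ 0ℤ
    other-ports a′ a′≢a = trans (cong (λ h → f v a′ * + h) (here-other-port v a a′ a′≢a)) (ℤP.*-zeroʳ (f v a′))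

  totalPotential-fire : ∀ v a c →
    totalPotential (newState N v a c) ≡ totalPotential (state c) + (potential v (t (Pr v) a (state c v)) - potential v (state c v))
  totalPotential-fire v a c = begin
    new                                     ≡⟨ solve new old ⟩
    old + (new - old)                       ≡⟨ cong (_+_ old) (∑-sub {n} (λ w → potential w (newState N v a c w)) (λ w → potential w (state c w))) ⟨
    old + ∑[ w < n ] change w               ≡⟨ cong (_+_ old) (∑-δ change v unchanged) ⟩
    old + change v                          ≡⟨ cong (λ s → old + (potential v s - potential v (state c v))) (newState-self v a c) ⟩
    old + (potential v (t (Pr v) a (state c v)) - potential v (state c v)) ∎
    where
    open ≡-Reasoning
    new = totalPotential (newState N v a c)
    old = totalPotential (state c)
    change : Fin n → ℤ
    change w = potential w (newState N v a c w) - potential w (state c w)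
    unchanged : ∀ w → w ≢ v → change w ≡ 0ℤ
    unchanged w w≢v = trans (cong (λ s → potential w s - potential w (state c w)) (newState-other v a c w w≢v))
                            (ℤP.+-inverseʳ (potential w (state c w)))
    solve : ∀ x y → x ≡ y + (x - y)
    solve = solve-∀

  contrib-feeds : ∀ v a q s → + contrib N v a q s ≡ ∑[ b < nB (Pr v) ] (+ o (Pr v) a q b * feeds v b s)
  contrib-feeds v a q (inj₁ _) = sym (∑-zero _ (λ b → ℤP.*-zeroʳ (+ o (Pr v) a q b)))
  contrib-feeds v a q (inj₂ (u , b′)) = by-node (u ≟ v)
    where
    by-node : Dec (u ≡ v) → + contrib N v a q (inj₂ (u , b′)) ≡ ∑[ b < nB (Pr v) ] (+ o (Pr v) a q b * feeds v b (inj₂ (u , b′)))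
    by-node (no u≢v) = trans (cong +_ (contrib-other-node v a q u b′ u≢v))
      (sym (∑-zero _ (λ b → trans (cong (+ o (Pr v) a q b *_) (feeds-other-node v b u b′ u≢v)) (ℤP.*-zeroʳ (+ o (Pr v) a q b)))))
    by-node (yes refl) = sym (begin
      ∑[ b < nB (Pr v) ] (+ o (Pr v) a q b * feeds v b (inj₂ (v , b′)))
          ≡⟨ ∑-δ _ b′ (λ b b≢b′ → trans (cong (+ o (Pr v) a q b *_) (feeds-other-output v b b′ (b≢b′ ∘ sym))) (ℤP.*-zeroʳ (+ o (Pr v) a q b))) ⟩
      + o (Pr v) a q b′ * feeds v b′ (inj₂ (v , b′))
          ≡⟨ cong (+ o (Pr v) a q b′ *_) (feeds-self v b′) ⟩
      + o (Pr v) a q b′ * + 1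
          ≡⟨ ℤP.*-identityʳ _ ⟩
      + o (Pr v) a q b′
          ≡⟨ cong +_ (contrib-self v a q b′) ⟨
      + contrib N v a q (inj₂ (v , b′))
          ∎)
      where open ≡-Reasoning

  emission : ∀ v a q →
    ∑ports (λ w a′ → weight w a′ * + contrib N v a q (src w a′)) + outputWeight * + contrib N v a q outSrc
      ≡ emitted (Pr v) (edgeWeight (suc stage) v) a q
  emission v a q = begin
    ∑ports (λ w a′ → weight w a′ * + contrib N v a q (src w a′)) + outputWeight * + contrib N v a q outSrc
         ≡⟨ cong₂ _+_ (∑∑-cong (λ w a′ → deposit (weight w a′) (src w a′))) (deposit outputWeight outSrc) ⟩
    ∑ports (λ w a′ → ∑[ b < B ] (ob b * toPort w a′ b)) + ∑[ b < B ] (ob b * toOutput b)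
         ≡⟨ cong (_+ ∑[ b < B ] (ob b * toOutput b)) (∑∑-swap (λ w a′ b → ob b * toPort w a′ b)) ⟩
    ∑[ b < B ] ∑ports (λ w a′ → ob b * toPort w a′ b) + ∑[ b < B ] (ob b * toOutput b)
         ≡⟨ cong (_+ ∑[ b < B ] (ob b * toOutput b)) (sum-cong-≗ {B} (λ b → ∑∑-scale (ob b) (λ w a′ → toPort w a′ b))) ⟩
    ∑[ b < B ] (ob b * ∑ports (λ w a′ → toPort w a′ b)) + ∑[ b < B ] (ob b * toOutput b)
         ≡⟨ ∑-distrib-+ {B} (λ b → ob b * ∑ports (λ w a′ → toPort w a′ b)) (λ b → ob b * toOutput b) ⟨
    ∑[ b < B ] (ob b * ∑ports (λ w a′ → toPort w a′ b) + ob b * toOutput b)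
         ≡⟨ sum-cong-≗ {B} (λ b → sym (ℤP.*-distribˡ-+ (ob b) _ _)) ⟩
    emitted (Pr v) (edgeWeight (suc stage) v) a q
         ∎
    where
    open ≡-Reasoning
    B = nB (Pr v)
    ob : Fin B → ℤ
    ob b = + o (Pr v) a q b
    toPort : (w : Fin n) → Fin (nA (Pr w)) → Fin B → ℤ
    toPort w a′ b = weight w a′ * feeds v b (src w a′)
    toOutput : Fin B → ℤ
    toOutput b = outputWeight * feeds v b outSrc
    swap : ∀ x y z → x * (y * z) ≡ y * (x * z)
    swap = solve-∀
    deposit : ∀ X s → X * + contrib N v a q s ≡ ∑[ b < B ] (ob b * (X * feeds v b s))
    deposit X s = trans (cong (X *_) (contrib-feeds v a q s))
                        (trans (*-distribˡ-sum {B} X (λ b → ob b * feeds v b s))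
                               (sum-cong-≗ {B} (λ b → swap X (ob b) (feeds v b s))))

  fire-preserves : ∀ v a c → 0 < cnt c v a → value (fire N v a c) ≡ value c
  fire-preserves v a c pos = begin
    value (fire N v a c)
         ≡⟨ cong₂ (λ x y → x + y + totalPotential (newState N v a c)) counts output ⟩
    S - weight v a + X + (outputWeight * + out c + Y) + totalPotential (newState N v a c)
         ≡⟨ cong (_+_ (S - weight v a + X + (outputWeight * + out c + Y))) (totalPotential-fire v a c) ⟩
    S - weight v a + X + (outputWeight * + out c + Y) + (Φ + Δ)
         ≡⟨ regroup S (weight v a) X (outputWeight * + out c) Y Φ Δ ⟩
    value c + (X + Y + Δ - weight v a)
         ≡⟨ cong (λ e → value c + (e + Δ - weight v a)) (emission v a q) ⟩
    value c + (E + Δ - weight v a)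
         ≡⟨ cong (λ w → value c + (E + Δ - w)) (balance v a q) ⟩
    value c + (E + Δ - (E + Δ))
         ≡⟨ cancel (value c) (E + Δ) ⟩
    value c
         ∎
    where
    open ≡-Reasoning
    q = state c v
    S = ∑ports (λ w a′ → weight w a′ * + cnt c w a′)
    X = ∑ports (λ w a′ → weight w a′ * + contrib N v a q (src w a′))
    Y = outputWeight * + contrib N v a q outSrc
    Φ = totalPotential (state c)
    Δ = potential v (t (Pr v) a q) - potential v q
    E = emitted (Pr v) (edgeWeight (suc stage) v) a q
    regroup : ∀ s w x o y φ δ → s - w + x + (o + y) + (φ + δ) ≡ s + o + φ + (x + y + δ - w)
    regroup = solve-∀
    cancel : ∀ x e → x + (e - e) ≡ x
    cancel = solve-∀
    counts : ∑ports (λ w a′ → weight w a′ * + cnt (fire N v a c) w a′) ≡ S - weight v a + X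
    counts = begin
      ∑ports (λ w a′ → weight w a′ * + (cnt c w a′ ∸ here N v a w a′ ℕ.+ contrib N v a q (src w a′)))
          ≡⟨ ∑∑-cong (λ w a′ → port w a′) ⟩
      ∑ports (λ w a′ → weight w a′ * + cnt c w a′ - weight w a′ * + here N v a w a′ + weight w a′ * + contrib N v a q (src w a′))
          ≡⟨ ∑∑-distrib-+ _ _ ⟩
      ∑ports (λ w a′ → weight w a′ * + cnt c w a′ - weight w a′ * + here N v a w a′) + X
          ≡⟨ cong (_+ X) (∑∑-sub _ _) ⟩
      S - ∑ports (λ w a′ → weight w a′ * + here N v a w a′) + X
          ≡⟨ cong (λ h → S - h + X) (∑ports-here weight v a) ⟩
      S - weight v a + X
          ∎
      where
      expand : ∀ w x h y → w * (x - h + y) ≡ w * x - w * h + w * y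
      expand = solve-∀
      port : ∀ w a′ → weight w a′ * + (cnt c w a′ ∸ here N v a w a′ ℕ.+ contrib N v a q (src w a′))
                    ≡ weight w a′ * + cnt c w a′ - weight w a′ * + here N v a w a′ + weight w a′ * + contrib N v a q (src w a′)
      port w a′ = trans (cong (weight w a′ *_) (trans (ℤP.pos-+ (cnt c w a′ ∸ here N v a w a′) (contrib N v a q (src w a′)))
                                                      (cong (_+ + contrib N v a q (src w a′)) (pos-∸ (here≤cnt c v a pos w a′)))))
                        (expand (weight w a′) _ _ _)
    output : outputWeight * + (out c ℕ.+ contrib N v a q outSrc) ≡ outputWeight * + out c + Y
    output = trans (cong (outputWeight *_) (ℤP.pos-+ (out c) _)) (ℤP.*-distribˡ-+ outputWeight _ _)

  run-preserves : ∀ {c c′} → Star (Step N) c c′ → value c′ ≡ value c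
  run-preserves ε                          = refl
  run-preserves (step v a c pos ◅ steps) = trans (run-preserves steps) (fire-preserves v a c pos)

  inputValue : ℤ
  inputValue = ∑ports (λ w a → weight w a * + fromInput N (src w a) 1) + outputWeight * + fromInput N outSrc 1

  value-initial : ∀ x → value (initial N x) ≡ inputValue * + x + totalPotential init
  value-initial x = cong (_+ totalPotential init) (begin
    ∑ports (λ w a → weight w a * + fromInput N (src w a) x) + outputWeight * + fromInput N outSrc x
         ≡⟨ cong₂ _+_ (∑∑-cong (λ w a → linear (weight w a) (src w a))) (linear outputWeight outSrc) ⟩
    ∑ports (λ w a → + x * (weight w a * + fromInput N (src w a) 1)) + + x * (outputWeight * + fromInput N outSrc 1)
         ≡⟨ cong (_+ + x * (outputWeight * + fromInput N outSrc 1)) (∑∑-scale (+ x) _) ⟩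
    + x * ∑ports (λ w a → weight w a * + fromInput N (src w a) 1) + + x * (outputWeight * + fromInput N outSrc 1)
         ≡⟨ ℤP.*-distribˡ-+ (+ x) _ _ ⟨
    + x * inputValue
         ≡⟨ ℤP.*-comm (+ x) inputValue ⟩
    inputValue * + x
         ∎)
    where
    open ≡-Reasoning
    one-letter : ∀ s → + fromInput N s x ≡ + fromInput N s 1 * + x
    one-letter (inj₁ _) = sym (ℤP.*-identityˡ (+ x))
    one-letter (inj₂ _) = refl
    linear : ∀ X s → X * + fromInput N s x ≡ + x * (X * + fromInput N s 1)
    linear X s = trans (cong (X *_) (one-letter s)) (solve X (+ fromInput N s 1) (+ x))
      where solve : ∀ a b c → a * (b * c) ≡ c * (a * b)
            solve = solve-∀

  value-halted : ∀ c → Halted N c → value c ≡ outputWeight * + out c + totalPotential (state c)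
  value-halted c halted = cong (_+ totalPotential (state c)) (trans
    (cong (_+ outputWeight * + out c)
      (∑-zero _ (λ w → ∑-zero _ (λ a → trans (cong (λ k → weight w a * + k) (halted w a)) (ℤP.*-zeroʳ (weight w a))))))
    (ℤP.+-identityˡ (outputWeight * + out c)))

  potentialBound : ℕ
  potentialBound = ℕΣ.sum (λ w → ℕΣ.sum (λ q → Int.∣ potential w q ∣))

  totalPotential-bounded : ∀ σ → Int.∣ totalPotential σ ∣ ≤ potentialBound
  totalPotential-bounded σ = ∣∑∣≤∑ (λ w → potential w (σ w)) _ (λ w → term≤∑ (λ q → Int.∣ potential w q ∣) (σ w))

  run-balance : ∀ x c → Star (Step N) (initial N x) c → Halted N c →
                outputWeight * + out c + totalPotential (state c) ≡ inputValue * + x + totalPotential init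
  run-balance x c run halted = trans (sym (value-halted c halted)) (trans (run-preserves run) (value-initial x))

  -- If the network computes x ↦ ⌊(x + q)/p⌋, then feeding it m·p letters
  -- outputs m letters, so (outputWeight − p·inputValue)·m is a difference
  -- of two total potentials for every m.  Being bounded, it vanishes.
  toppler-weights : ∀ p .{{_ : NonZero p}} q → q < p → Computes N (toppler p q) →
                    outputWeight ≡ inputValue * + p
  toppler-weights p q q<p computes =
    ℤP.i-j≡0⇒i≡j outputWeight (inputValue * + p) (bounded-multiples D (potentialBound ℕ.+ potentialBound) bounded)
    where
    D = outputWeight - inputValue * + p
    bounded : ∀ m → Int.∣ D * + m ∣ ≤ potentialBound ℕ.+ potentialBound
    bounded m with computes (m ℕ.* p)
    ... | (c , run , halted) , outputs = begin
      Int.∣ D * + m ∣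
          ≡⟨ cong Int.∣_∣ (rearrange outputWeight inputValue (+ p) (+ m) (totalPotential (state c)) (totalPotential init) balanced) ⟩
      Int.∣ totalPotential init - totalPotential (state c) ∣
          ≤⟨ ℤP.∣i-j∣≤∣i∣+∣j∣ (totalPotential init) (totalPotential (state c)) ⟩
      Int.∣ totalPotential init ∣ ℕ.+ Int.∣ totalPotential (state c) ∣
          ≤⟨ ℕP.+-mono-≤ (totalPotential-bounded init) (totalPotential-bounded (state c)) ⟩
      potentialBound ℕ.+ potentialBound
          ∎
      where
      open ℕP.≤-Reasoning
      out≡m : out c ≡ m
      out≡m = trans (outputs c run halted) (toppler-multiple p q m q<p)
      balanced : outputWeight * + m + totalPotential (state c) ≡ inputValue * (+ m * + p) + totalPotential init
      balanced = subst₂ (λ k x → outputWeight * + k + totalPotential (state c) ≡ inputValue * x + totalPotential init)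
                        out≡m (ℤP.pos-* m p) (run-balance (m ℕ.* p) c run halted)
      rearrange : ∀ wo i p m φ φ₀ → wo * m + φ ≡ i * (m * p) + φ₀ → (wo - i * p) * m ≡ φ₀ - φ
      rearrange wo i p m φ φ₀ eq =
        trans (solve₁ wo i p m φ) (trans (cong (λ e → e - φ - i * (m * p)) eq) (solve₂ i p m φ₀ φ))
        where solve₁ : ∀ wo i p m φ → (wo - i * p) * m ≡ wo * m + φ - φ - i * (m * p)
              solve₁ = solve-∀
              solve₂ : ∀ i p m φ₀ φ → i * (m * p) + φ₀ - φ - i * (m * p) ≡ φ₀ - φ
              solve₂ = solve-∀

  -- Since outputWeight is a power of K, p divides a power of K.
  no-toppler : ∀ p .{{_ : NonZero p}} → p ≡ suc K → ∀ q → q < p → ¬ Computes N (toppler p q)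
  no-toppler p p≡1+K q q<p computes =
    suc-∤-power K (commonPeriod-pos L) (suc M ℕ.* suc stage) (subst (_∣ K ^ (suc M ℕ.* suc stage)) p≡1+K p∣Kᵉ)
    where
    p∣Kᵉ : p ∣ K ^ (suc M ℕ.* suc stage)
    p∣Kᵉ = divides Int.∣ inputValue ∣ (begin
      K ^ (suc M ℕ.* suc stage)      ≡⟨ ℕP.^-*-assoc K (suc M) (suc stage) ⟨
      Int.∣ outputWeight ∣             ≡⟨ cong Int.∣_∣ (toppler-weights p q q<p computes) ⟩
      Int.∣ inputValue * + p ∣          ≡⟨ ℤP.∣i*j∣≡∣i∣*∣j∣ inputValue (+ p) ⟩
      Int.∣ inputValue ∣ ℕ.* p         ∎)
      where open ≡-Reasoning

open import Data.Nat using (_+_)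

corollary7p3 : (L : List Processor) →
    All (λ P → IsAbelian P × IsRecurrent P × AllReachable P) L →
    ∃[ k ] ((N : Net L) → WellWired N → Acyclic N →
      (q : Fin (2 + k)) → ¬ Computes N (toppler (2 + k) (toℕ q)))
corollary7p3 L valid = commonPeriod L ∸ 1 , λ N _ acyclic q →
  Conservation.no-toppler valid N acyclic (2 + (commonPeriod L ∸ 1)) p≡1+K (toℕ q) (toℕ<n q)
  where
  -- with K = commonPeriod L > 0, the toppler size 2 + (K ∸ 1) is K + 1
  p≡1+K : 2 + (commonPeriod L ∸ 1) ≡ 1 + commonPeriod L
  p≡1+K = cong (1 +_) (ℕP.m+[n∸m]≡n (commonPeriod-pos L))
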